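{- Let $d\ge 1$. The set $X=(L_0\cup L_d)\setminus\{[0,11\cdots1],[d,11\cdots1]\}$ is a mutual-visibility set of $\mathit{BF}(d)$, where $L_j=\{[j,c] : c\in\{0,1\}^d\}$ and $11\cdots 1$ denotes the all-ones string of length $d$.
   Context: For a connected graph $G$ and $X\subseteq V(G)$, two vertices $x,y\in V(G)$ are $X$-visible if there is a shortest $x,y$-path none of whose internal vertices lies in $X$. $X$ is a mutual-visibility set if every two vertices of $X$ are $X$-visible. The $d$-dimensional butterfly $\mathit{BF}(d)$ has vertex set $\{[\ell,c] : \ell\in\{0,1,\dots,d\},\ c\in\{0,1\}^d\}$ ($\ell$ is the level, $c$ the column); for $\ell\in\{1,\dots,d\}$, the vertex $[\ell-1,c]$ is adjacent to $[\ell,c']$ if and only if either $c=c'$ or $c$ and $c'$ differ exactly in the $\ell$-th bit (bits counted from the left starting at 1); there are no other edges. -}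

module Defs where

open import Data.Nat using (ℕ; zero; suc; _<_)
open import Data.Fin using (Fin; inject₁; fromℕ) renaming (zero to fzero; suc to fsuc)
open import Data.Bool using (Bool; true; false; not)
open import Data.Vec using (Vec; replicate; _[_]%=_)
open import Data.Product using (_×_; _,_; Σ; ∃; ∃-syntax; proj₁; proj₂)
open import Data.Sum using (_⊎_)
open import Data.List using (List; []; _∷_; length)
open import Relation.Binary.PropositionalEquality using (_≡_)
open import Relation.Nullary using (¬_)

Vertex : ℕ → Set
Vertex d = Fin (suc d) × Vec Bool d

level : ∀ {d} → Vertex d → Fin (suc d)
level = proj₁

column : ∀ {d} → Vertex d → Vec Bool d
column = proj₂

-- Edges between level ℓ-1 and level ℓ (ℓ = i+1 for i : Fin d).
-- The ℓ-th bit from the left (1-based) is position i (0-based) of the vector.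
-- [ℓ-1 , c] is adjacent to [ℓ , c'] iff c' = c or c' is c with bit ℓ flipped.
data DownEdge {d : ℕ} : Vertex d → Vertex d → Set where
  straight : (i : Fin d) (c : Vec Bool d) →
             DownEdge (inject₁ i , c) (fsuc i , c)
  cross    : (i : Fin d) (c : Vec Bool d) →
             DownEdge (inject₁ i , c) (fsuc i , c [ i ]%= not)

Adj : ∀ {d} → Vertex d → Vertex d → Set
Adj u v = DownEdge u v ⊎ DownEdge v u

data Walk {d : ℕ} : Vertex d → Vertex d → Set where
  [_]  : (x : Vertex d) → Walk x x
  _∷⟨_⟩_ : (x : Vertex d) {y z : Vertex d} → Adj x y → Walk y z → Walk x z

infixr 5 _∷⟨_⟩_

len : ∀ {d} {x y : Vertex d} → Walk x y → ℕ
len [ _ ] = zero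
len (_ ∷⟨ _ ⟩ w) = suc (len w)

internal : ∀ {d} {x y : Vertex d} → Walk x y → List (Vertex d)
internal [ _ ] = []
internal (_ ∷⟨ _ ⟩ [ _ ]) = []
internal (_ ∷⟨ _ ⟩ (v ∷⟨ e ⟩ w)) = v ∷ internal (v ∷⟨ e ⟩ w)

data AllL {A : Set} (P : A → Set) : List A → Set where
  []  : AllL P []
  _∷_ : ∀ {a as} → P a → AllL P as → AllL P (a ∷ as)

-- A shortest x,y-walk (which is necessarily a path).
IsShortest : ∀ {d} {x y : Vertex d} → Walk x y → Set
IsShortest {x = x} {y = y} p = (q : Walk x y) → ¬ (len q < len p)

VSet : ℕ → Set₁
VSet d = Vertex d → Set

Visible : ∀ {d} → VSet d → Vertex d → Vertex d → Set
Visible X x y = Σ (Walk x y) λ p → IsShortest p × AllL (λ v → ¬ X v) (internal p)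

IsMutualVisibility : ∀ {d} → VSet d → Set
IsMutualVisibility {d} X = (x y : Vertex d) → X x → X y → Visible X x y

L : ∀ {d} → Fin (suc d) → VSet d
L j v = level v ≡ j

ones : ∀ d → Vec Bool d
ones d = replicate d true

Xset : ∀ d → VSet d
Xset d v = (L fzero v ⊎ L (fromℕ d) v)
         × ¬ (v ≡ (fzero , ones d))
         × ¬ (v ≡ (fromℕ d , ones d))

-- A walk in BF(d) changes its level by one per step and can change bit i of the
-- column only on an edge between levels i-1 and i. So a walk between two columns
-- differing in bit i must visit both these levels, which bounds its length from
-- below. For two vertices of L₀ take the last bit i where they differ: the walk
-- climbing to level i while turning every bit it passes into 1, then descending
-- to the other vertex, meets this bound, and its only vertex of L_d (reached when
-- i = d) lies in column 11⋯1. Symmetrically, two vertices of L_d are joined via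
-- level i-1 for the first differing bit i, and when i = 1 the walk passes through
-- L₀ only at [0,11⋯1]. A vertex of L₀ and one of L_d are joined by a monotone walk
-- of length d, whose internal vertices lie strictly between the two levels.
module Submission where

open import Defs
open import Data.Nat using (ℕ; zero; suc; _+_; _≤_; _<_; _≥_; s≤s; ∣_-_∣)
open import Data.Nat.Properties
  using (≤-trans; ≤-reflexive; +-suc; +-comm; +-mono-≤; +-monoˡ-≤; <⇒≱; ∣n-n∣≡0; ∣-∣-comm; ∣-∣-triangle; module ≤-Reasoning)
open import Data.Fin using (Fin; toℕ; inject₁; fromℕ) renaming (zero to fzero; suc to fsuc)
open import Data.Fin.Properties using (toℕ-inject₁; suc-injective) renaming (_≟_ to _≟ᶠ_)
open import Data.Bool using (Bool; true; false)
open import Data.Bool.Properties using () renaming (_≟_ to _≟ᵇ_)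
open import Data.Vec using (Vec; []; _∷_; lookup)
open import Data.Vec.Properties using (≡-dec; lookup∘updateAt′)
open import Data.Product using (_×_; _,_; Σ; ∃; proj₁; proj₂)
import Data.Product as Product
open import Data.Sum using (_⊎_; inj₁; inj₂)
import Data.Sum as Sum
open import Data.Empty using (⊥-elim)
open import Function using (_∘_)
open import Relation.Binary.PropositionalEquality
  using (_≡_; _≢_; refl; sym; trans; cong; cong₂; subst; subst₂; module ≡-Reasoning)
open import Relation.Nullary using (¬_; yes; no)

private
  variable
    d : ℕ
    x y z : Vertex d
    l : Fin (suc d)
    P Q : Vertex d → Set

mapAllL : (∀ {v} → P v → Q v) → ∀ {vs} → AllL P vs → AllL Q vs
mapAllL f []       = []
mapAllL f (p ∷ ps) = f p ∷ mapAllL f ps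

infixr 5 _++ʷ_

_++ʷ_ : Walk x y → Walk y z → Walk x z
[ _ ]        ++ʷ w = w
(x ∷⟨ e ⟩ u) ++ʷ w = x ∷⟨ e ⟩ (u ++ʷ w)

len-++ : (u : Walk x y) (w : Walk y z) → len (u ++ʷ w) ≡ len u + len w
len-++ [ _ ]        w = refl
len-++ (x ∷⟨ e ⟩ u) w = cong suc (len-++ u w)

reverse : Walk x y → Walk y x
reverse [ x ]                = [ x ]
reverse (_∷⟨_⟩_ x {y} e w) = reverse w ++ʷ (y ∷⟨ Sum.swap e ⟩ [ x ])

len-reverse : (w : Walk x y) → len (reverse w) ≡ len w
len-reverse [ x ]                = refl
len-reverse (_∷⟨_⟩_ x {y} e w) = begin
  len (reverse w ++ʷ (y ∷⟨ Sum.swap e ⟩ [ x ])) ≡⟨ len-++ (reverse w) _ ⟩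
  len (reverse w) + 1                      ≡⟨ +-comm (len (reverse w)) 1 ⟩
  suc (len (reverse w))                    ≡⟨ cong suc (len-reverse w) ⟩
  suc (len w)                              ∎
  where open ≡-Reasoning

internal-∷ : (e : Adj x y) (w : Walk y z) →
             P y → AllL P (internal w) → AllL P (internal (x ∷⟨ e ⟩ w))
internal-∷ e [ _ ]         py ps = []
internal-∷ e (y ∷⟨ _ ⟩ w) py ps = py ∷ ps

internal-++ : (u : Walk x y) (w : Walk y z) →
              AllL P (internal u) → P y → AllL P (internal w) → AllL P (internal (u ++ʷ w))
internal-++ [ _ ]                     w ps       py qs = qs
internal-++ (x ∷⟨ e ⟩ [ _ ])          w ps       py qs = internal-∷ e w py qs
internal-++ (x ∷⟨ e ⟩ (v ∷⟨ f ⟩ u)) w (pv ∷ ps) py qs = pv ∷ internal-++ (v ∷⟨ f ⟩ u) w ps py qs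

internal-reverse : (w : Walk x y) → AllL P (internal w) → AllL P (internal (reverse w))
internal-reverse [ _ ]                     ps        = []
internal-reverse (x ∷⟨ e ⟩ [ _ ])          ps        = []
internal-reverse (x ∷⟨ e ⟩ (v ∷⟨ f ⟩ w)) (pv ∷ ps) =
  internal-++ (reverse (v ∷⟨ f ⟩ w)) _ (internal-reverse (v ∷⟨ f ⟩ w) ps) pv []

IsShortest-reverse : (w : Walk x y) → IsShortest w → IsShortest (reverse w)
IsShortest-reverse w shortest q q<w =
  shortest (reverse q) (subst₂ _<_ (sym (len-reverse q)) (len-reverse w) q<w)

Visible-sym : {X : VSet d} → Visible X x y → Visible X y x
Visible-sym (w , shortest , avoids) =
  reverse w , IsShortest-reverse w shortest , internal-reverse w avoids

-- BF(d) embeds into BF(d+1) as the vertices of level ≥ 1 with first bit b.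
lift : Bool → Vertex d → Vertex (suc d)
lift b v = fsuc (level v) , b ∷ column v

lift-DownEdge : (b : Bool) → DownEdge x y → DownEdge (lift b x) (lift b y)
lift-DownEdge b (straight i c) = straight (fsuc i) (b ∷ c)
lift-DownEdge b (cross i c)    = cross (fsuc i) (b ∷ c)

lift-Adj : (b : Bool) → Adj x y → Adj (lift b x) (lift b y)
lift-Adj b = Sum.map (lift-DownEdge b) (lift-DownEdge b)

liftʷ : (b : Bool) → Walk x y → Walk (lift b x) (lift b y)
liftʷ b [ x ]          = [ lift b x ]
liftʷ b (x ∷⟨ e ⟩ w) = lift b x ∷⟨ lift-Adj b e ⟩ liftʷ b w

len-liftʷ : (b : Bool) (w : Walk x y) → len (liftʷ b w) ≡ len w
len-liftʷ b [ x ]          = refl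
len-liftʷ b (x ∷⟨ e ⟩ w) = cong suc (len-liftʷ b w)

internal-liftʷ : {Q : Vertex (suc d) → Set} (b : Bool) → (∀ {v} → P v → Q (lift b v)) →
                 (w : Walk x y) → AllL P (internal w) → AllL Q (internal (liftʷ b w))
internal-liftʷ b f [ _ ]                     ps        = []
internal-liftʷ b f (x ∷⟨ e ⟩ [ _ ])          ps        = []
internal-liftʷ b f (x ∷⟨ e ⟩ (v ∷⟨ e′ ⟩ w)) (pv ∷ ps) = f pv ∷ internal-liftʷ b f (v ∷⟨ e′ ⟩ w) ps

bottom-edge : (b b′ : Bool) (c : Vec Bool d) → DownEdge {suc d} (fzero , b ∷ c) (fsuc fzero , b′ ∷ c)
bottom-edge false false c = straight fzero (false ∷ c)
bottom-edge true  true  c = straight fzero (true ∷ c)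
bottom-edge false true  c = cross fzero (false ∷ c)
bottom-edge true  false c = cross fzero (true ∷ c)

levelℕ : Vertex d → ℕ
levelℕ = toℕ ∘ level

dist : Vertex d → Vertex d → ℕ
dist x y = ∣ levelℕ x - levelℕ y ∣

-- a lower bound on the length of a walk from x to y that visits level l
detour : Vertex d → Fin (suc d) → Vertex d → ℕ
detour x l y = ∣ levelℕ x - toℕ l ∣ + ∣ toℕ l - levelℕ y ∣

∣n-1+n∣≡1 : ∀ n → ∣ n - suc n ∣ ≡ 1
∣n-1+n∣≡1 zero    = refl
∣n-1+n∣≡1 (suc n) = ∣n-1+n∣≡1 n

DownEdge-dist : DownEdge x y → dist x y ≡ 1
DownEdge-dist (straight i c) rewrite toℕ-inject₁ i = ∣n-1+n∣≡1 (toℕ i)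
DownEdge-dist (cross i c)    rewrite toℕ-inject₁ i = ∣n-1+n∣≡1 (toℕ i)

Adj-dist : Adj x y → dist x y ≤ 1
Adj-dist {x = x} {y} (inj₁ e) = ≤-reflexive (DownEdge-dist e)
Adj-dist {x = x} {y} (inj₂ e) =
  ≤-reflexive (trans (∣-∣-comm (levelℕ x) (levelℕ y)) (DownEdge-dist e))

dist≤len : (w : Walk x y) → dist x y ≤ len w
dist≤len [ x ]                 = ≤-reflexive (∣n-n∣≡0 (levelℕ x))
dist≤len (_∷⟨_⟩_ x {v} {y} e w) =
  ≤-trans (∣-∣-triangle (levelℕ x) (levelℕ v) (levelℕ y)) (+-mono-≤ (Adj-dist e) (dist≤len w))

detour-start : level x ≡ l → (w : Walk x y) → detour x l y ≤ len w
detour-start {x = x} refl w rewrite ∣n-n∣≡0 (levelℕ x) = dist≤len w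

detour-∷ : (l : Fin (suc d)) (e : Adj x y) (w : Walk y z) →
           detour y l z ≤ len w → detour x l z ≤ len (x ∷⟨ e ⟩ w)
detour-∷ {x = x} {y = y} {z = z} l e w h = begin
  ∣ levelℕ x - toℕ l ∣ + ∣ toℕ l - levelℕ z ∣
    ≤⟨ +-monoˡ-≤ _ (∣-∣-triangle (levelℕ x) (levelℕ y) (toℕ l)) ⟩
  (dist x y + ∣ levelℕ y - toℕ l ∣) + ∣ toℕ l - levelℕ z ∣
    ≤⟨ +-monoˡ-≤ _ (+-monoˡ-≤ _ (Adj-dist e)) ⟩
  suc (detour y l z)
    ≤⟨ s≤s h ⟩
  suc (len w) ∎
  where open ≤-Reasoning

DownEdge-flip : DownEdge x y → (i : Fin d) → lookup (column x) i ≢ lookup (column y) i →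
                level x ≡ inject₁ i × level y ≡ fsuc i
DownEdge-flip (straight j c) i differs = ⊥-elim (differs refl)
DownEdge-flip (cross j c)    i differs with i ≟ᶠ j
... | yes refl = refl , refl
... | no  i≢j  = ⊥-elim (differs (sym (lookup∘updateAt′ i j i≢j c)))

Adj-flip : Adj x y → (i : Fin d) → lookup (column x) i ≢ lookup (column y) i →
           (level x ≡ inject₁ i × level y ≡ fsuc i) ⊎ (level x ≡ fsuc i × level y ≡ inject₁ i)
Adj-flip (inj₁ e) i differs = inj₁ (DownEdge-flip e i differs)
Adj-flip (inj₂ e) i differs = inj₂ (Product.swap (DownEdge-flip e i (differs ∘ sym)))

crossing : (w : Walk x y) (i : Fin d) → lookup (column x) i ≢ lookup (column y) i →
           detour x (inject₁ i) y ≤ len w × detour x (fsuc i) y ≤ len w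
crossing [ x ] i differs = ⊥-elim (differs refl)
crossing (_∷⟨_⟩_ x {v} e w) i differs with lookup (column x) i ≟ᵇ lookup (column v) i
... | yes same with crossing w i (differs ∘ trans same)
...   | below , above = detour-∷ (inject₁ i) e w below , detour-∷ (fsuc i) e w above
crossing (_∷⟨_⟩_ x {v} e w) i differs | no flips with Adj-flip e i flips
...   | inj₁ (x-low , v-high) = detour-start x-low (x ∷⟨ e ⟩ w) , detour-∷ (fsuc i) e w (detour-start v-high w)
...   | inj₂ (x-high , v-low) = detour-∷ (inject₁ i) e w (detour-start v-low w) , detour-start x-high (x ∷⟨ e ⟩ w)

Route : (Vertex d → Set) → Vertex d → Vertex d → ℕ → Set
Route P x y n = Σ (Walk x y) λ w → len w ≡ n × AllL P (internal w)

Avoiding : Fin (suc d) → Fin (suc d) → Vertex d → Set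
Avoiding {d} j k v = level v ≢ j × (level v ≡ k → column v ≡ ones d)

∉Xset : (level x ≡ fzero → column x ≡ ones d) → (level x ≡ fromℕ d → column x ≡ ones d) → ¬ Xset d x
∉Xset bottom⇒ones top⇒ones (inj₁ bottom , ≢bottom-ones , _) = ≢bottom-ones (cong₂ _,_ bottom (bottom⇒ones bottom))
∉Xset bottom⇒ones top⇒ones (inj₂ top , _ , ≢top-ones)       = ≢top-ones (cong₂ _,_ top (top⇒ones top))

Avoiding-bottom⇒∉Xset : Avoiding fzero (fromℕ d) x → ¬ Xset d x
Avoiding-bottom⇒∉Xset (≢bottom , top⇒ones) = ∉Xset (⊥-elim ∘ ≢bottom) top⇒ones

Avoiding-top⇒∉Xset : Avoiding (fromℕ d) fzero x → ¬ Xset d x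
Avoiding-top⇒∉Xset (≢top , bottom⇒ones) = ∉Xset bottom⇒ones (⊥-elim ∘ ≢top)

lift-Avoiding-top : (b : Bool) → level x ≢ fromℕ d → Avoiding (fromℕ (suc d)) fzero (lift b x)
lift-Avoiding-top b ≢top = ≢top ∘ suc-injective , λ ()

lift-true-Avoiding-bottom : (level x ≡ fromℕ d → column x ≡ ones d) →
                            Avoiding fzero (fromℕ (suc d)) (lift true x)
lift-true-Avoiding-bottom top⇒ones = (λ ()) , cong (true ∷_) ∘ top⇒ones ∘ suc-injective

zero≡fromℕ⇒≡ones : (c : Vec Bool d) → fzero ≡ fromℕ d → c ≡ ones d
zero≡fromℕ⇒≡ones {zero} [] _ = refl

visible : {X : VSet d} {n : ℕ} → (∀ {v} → P v → ¬ X v) →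
          Route P x y n → (∀ (q : Walk x y) → n ≤ len q) → Visible X x y
visible ∉X (w , len-w , avoids) lower-bound =
  w , (λ q q<w → <⇒≱ q<w (subst (_≤ len q) (sym len-w) (lower-bound q))) , mapAllL ∉X avoids

bottom-to-top : (c c′ : Vec Bool d) →
                Route (Avoiding (fromℕ d) fzero) (fzero , c) (fromℕ d , c′) (dist (fzero , c) (fromℕ d , c′))
bottom-to-top {zero}        []      []        = [ _ ] , refl , []
-- For d = 1 the vertex reached by the first step is the endpoint, which need not avoid L_d.
bottom-to-top {suc zero}    (b ∷ []) (b′ ∷ []) = _ ∷⟨ inj₁ (bottom-edge b b′ []) ⟩ [ _ ] , refl , []
bottom-to-top {suc (suc d)} (b ∷ c) (b′ ∷ c′) with bottom-to-top c c′
... | w , len-w , avoids =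
  _ ∷⟨ inj₁ (bottom-edge b b′ c) ⟩ liftʷ b′ w ,
  cong suc (trans (len-liftʷ b′ w) len-w) ,
  internal-∷ _ (liftʷ b′ w) (lift-Avoiding-top b′ λ ())
    (internal-liftʷ b′ (lift-Avoiding-top b′ ∘ proj₁) w avoids)

bottom-to-bottom : (c c′ : Vec Bool d) → c ≢ c′ → ∃ λ i → lookup c i ≢ lookup c′ i ×
  Route (Avoiding fzero (fromℕ d)) (fzero , c) (fzero , c′) (detour (fzero , c) (fsuc i) (fzero , c′))
bottom-to-bottom [] [] c≢c′ = ⊥-elim (c≢c′ refl)
bottom-to-bottom {suc d} (b ∷ c) (b′ ∷ c′) bc≢b′c′ with ≡-dec _≟ᵇ_ c c′
... | yes refl with b ≟ᵇ b′
...   | yes refl = ⊥-elim (bc≢b′c′ refl)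
...   | no b≢b′  =
  fzero , b≢b′ ,
  _ ∷⟨ inj₁ (bottom-edge b true c) ⟩ _ ∷⟨ inj₂ (bottom-edge b′ true c) ⟩ [ _ ] ,
  refl , lift-true-Avoiding-bottom (zero≡fromℕ⇒≡ones c) ∷ []
bottom-to-bottom {suc d} (b ∷ c) (b′ ∷ c′) _ | no c≢c′ with bottom-to-bottom c c′ c≢c′
...   | i , differs , w , len-w , avoids = fsuc i , differs , W , len-W , avoids-W
  where
    descend : Walk (fsuc fzero , true ∷ c′) (fzero , b′ ∷ c′)
    descend = _ ∷⟨ inj₂ (bottom-edge b′ true c′) ⟩ [ _ ]
    W : Walk (fzero , b ∷ c) (fzero , b′ ∷ c′)
    W = _ ∷⟨ inj₁ (bottom-edge b true c) ⟩ (liftʷ true w ++ʷ descend)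
    s = suc (toℕ i)
    len-W : len W ≡ suc s + suc s
    len-W = begin
      suc (len (liftʷ true w ++ʷ descend)) ≡⟨ cong suc (len-++ (liftʷ true w) descend) ⟩
      suc (len (liftʷ true w) + 1)          ≡⟨ cong (λ n → suc (n + 1)) (trans (len-liftʷ true w) len-w) ⟩
      suc (s + s + 1)                        ≡⟨ cong suc (+-comm (s + s) 1) ⟩
      suc (suc (s + s))                      ≡⟨ cong suc (sym (+-suc s s)) ⟩
      suc s + suc s                          ∎
      where open ≡-Reasoning
    avoids-W : AllL (Avoiding fzero (fromℕ (suc d))) (internal W)
    avoids-W = internal-∷ _ (liftʷ true w ++ʷ descend) (lift-true-Avoiding-bottom (zero≡fromℕ⇒≡ones c))
      (internal-++ (liftʷ true w) descend (internal-liftʷ true (lift-true-Avoiding-bottom ∘ proj₂) w avoids)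
        (lift-true-Avoiding-bottom (zero≡fromℕ⇒≡ones c′)) [])

top-to-top : (c c′ : Vec Bool d) → c ≢ c′ → ∃ λ i → lookup c i ≢ lookup c′ i ×
  Route (Avoiding (fromℕ d) fzero) (fromℕ d , c) (fromℕ d , c′) (detour (fromℕ d , c) (inject₁ i) (fromℕ d , c′))
top-to-top [] [] c≢c′ = ⊥-elim (c≢c′ refl)
top-to-top {suc d} (b ∷ c) (b′ ∷ c′) bc≢b′c′ with b ≟ᵇ b′
... | yes refl with top-to-top c c′ (bc≢b′c′ ∘ cong (b ∷_))
...   | i , differs , w , len-w , avoids =
  fsuc i , differs , liftʷ b w , trans (len-liftʷ b w) len-w ,
  internal-liftʷ b (lift-Avoiding-top b ∘ proj₁) w avoids
top-to-top {suc d} (b ∷ c) (b′ ∷ c′) _ | no b≢b′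
  with bottom-to-top (true ∷ ones d) (b ∷ c) | bottom-to-top (true ∷ ones d) (b′ ∷ c′)
... | w , len-w , avoids | w′ , len-w′ , avoids′ =
  fzero , b≢b′ , reverse w ++ʷ w′ ,
  trans (len-++ (reverse w) w′) (cong₂ _+_ (trans (len-reverse w) len-w) len-w′) ,
  internal-++ (reverse w) w′ (internal-reverse w avoids) ((λ ()) , λ _ → refl) avoids′

bottom-visible : (c c′ : Vec Bool d) → Visible (Xset d) (fzero , c) (fzero , c′)
bottom-visible c c′ with ≡-dec _≟ᵇ_ c c′
... | yes refl = [ _ ] , (λ _ ()) , []
... | no c≢c′ with bottom-to-bottom c c′ c≢c′
...   | i , differs , route =
  visible Avoiding-bottom⇒∉Xset route (λ q → proj₂ (crossing q i differs))

top-visible : (c c′ : Vec Bool d) → Visible (Xset d) (fromℕ d , c) (fromℕ d , c′)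
top-visible c c′ with ≡-dec _≟ᵇ_ c c′
... | yes refl = [ _ ] , (λ _ ()) , []
... | no c≢c′ with top-to-top c c′ c≢c′
...   | i , differs , route =
  visible Avoiding-top⇒∉Xset route (λ q → proj₁ (crossing q i differs))

bottom-top-visible : (c c′ : Vec Bool d) → Visible (Xset d) (fzero , c) (fromℕ d , c′)
bottom-top-visible c c′ = visible Avoiding-top⇒∉Xset (bottom-to-top c c′) dist≤len

lemma7 : (d : ℕ) → d ≥ 1 → IsMutualVisibility (Xset d)
lemma7 d _ (_ , c) (_ , c′) (inj₁ refl , _) (inj₁ refl , _) = bottom-visible c c′
lemma7 d _ (_ , c) (_ , c′) (inj₁ refl , _) (inj₂ refl , _) = bottom-top-visible c c′
lemma7 d _ (_ , c) (_ , c′) (inj₂ refl , _) (inj₁ refl , _) = Visible-sym (bottom-top-visible c′ c)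
lemma7 d _ (_ , c) (_ , c′) (inj₂ refl , _) (inj₂ refl , _) = top-visible c c′
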